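{- Let $a,b\in\mathbb{N}$ and $d=\gcd(a,b)$. If $a$ divides $b$ or $b$ divides $a$, then $\Gamma(a,b)=1$. Otherwise: (1) if $a/d$ is odd, then $\Gamma(a,b)=1$ if and only if $\Theta(b,a)$ is odd; (2) if $a/d$ is even, then $\Gamma(a,b)=1$ if and only if $\Theta(a,b)$ is odd.
   Context: $\mathbb{N}$ denotes the positive integers. For coprime $a,b\in\mathbb{N}$, consider the equations (E1) $ax+by=\frac{(a-1)(b-1)}{2}$ and (E2) $ax+by+1=\frac{(a-1)(b-1)}{2}$. We say the pair $(a,b)$ uses (E1) if (E1) has a solution in nonnegative integers $x,y$. For arbitrary $a,b\in\mathbb{N}$ with $d=\gcd(a,b)$, define $\Gamma(a,b)=1$ if the coprime pair $(a/d,b/d)$ uses (E1), and $\Gamma(a,b)=2$ otherwise. When $b/d>1$, $\Theta(a,b)$ denotes the unique integer with $0<\Theta(a,b)<b/d$ and $(a/d)\,\Theta(a,b)\equiv 1 \pmod{b/d}$ (so $\Theta(b,a)$ is defined when $a/d>1$, as the inverse of $b/d$ modulo $a/d$). -}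

module Defs where

open import Data.Nat using (ℕ; zero; suc; _+_; _*_; _∸_; _≤_; _<_)
open import Data.Nat.Divisibility using (_∣_; quotient)
open import Data.Nat.GCD using (gcd; gcd[m,n]∣m; gcd[m,n]∣n)
open import Data.Product using (Σ; ∃; _×_)
open import Relation.Binary.PropositionalEquality using (_≡_)
open import Relation.Nullary using (¬_)

red₁ : ℕ → ℕ → ℕ
red₁ a b = quotient (gcd[m,n]∣m a b)

red₂ : ℕ → ℕ → ℕ
red₂ a b = quotient (gcd[m,n]∣n a b)

-- For coprime a b: (E1)  a x + b y = (a-1)(b-1)/2  has a solution in ℕ.
-- (Equation multiplied by 2 to stay in ℕ; equivalent since both sides are rationals.)
UsesE1 : ℕ → ℕ → Set
UsesE1 a b = ∃ λ x → ∃ λ y → 2 * (a * x + b * y) ≡ (a ∸ 1) * (b ∸ 1)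

-- Γ(a,b) = 1  iff the reduced pair (a/d, b/d) uses (E1); otherwise Γ(a,b) = 2.
Γ≡1 : ℕ → ℕ → Set
Γ≡1 a b = UsesE1 (red₁ a b) (red₂ a b)

IsΘ : ℕ → ℕ → ℕ → Set
IsΘ a b t = 0 < t × t < red₂ a b × ∃ λ k → red₁ a b * t ≡ 1 + k * red₂ a b

Odd : ℕ → Set
Odd n = ¬ (2 ∣ n)

-- "Θ(a,b) is odd" (Θ(a,b) is unique when it exists)
ΘOdd : ℕ → ℕ → Set
ΘOdd a b = ∃ λ t → IsΘ a b t × Odd t

-- Clearing denominators, (E1) for a pair (A, B) reads 2(Ax + By) = (A - 1)(B - 1), which
-- rearranges to B(2y + 1) = 1 + (B - 1 - 2x)A: a solution yields the odd inverse t = 2y + 1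
-- of B modulo A, and t < A.  Conversely, if A is odd and B t = 1 + k A with t = 2m + 1 < A,
-- then k < B, parity forces B - 1 - k = 2s, and (x, y) = (s, m) solves (E1).  When A is even
-- we swap the roles of A and B (E1 is symmetric); B is then odd because A is invertible
-- modulo B.
module Submission where

open import Defs
open import Data.List using ([]; _∷_)
open import Data.Nat
  using (ℕ; zero; suc; _+_; _*_; _∸_; _≤_; _<_; _/_; _%_; z≤n; s≤s; z<s; NonZero; >-nonZero; ≢-nonZero)
open import Data.Nat.DivMod using (m≡m%n+[m/n]*n; m%n<n)
open import Data.Nat.Divisibility
  using (_∣_; divides; ∣-antisym; ∣-refl; ∣1⇒≡1; ∣m+n∣m⇒∣n; m∣m*n; ∣m⇒∣m*n; m%n≡0⇒n∣m)
open import Data.Nat.GCD using (gcd; gcd[m,n]∣m; gcd[m,n]∣n; gcd-comm; gcd-greatest; gcd[m,n]≢0)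
open import Data.Nat.Properties
open import Data.Nat.Tactic.RingSolver using (solve)
open import Data.Product using (_×_; ∃; _,_)
open import Data.Sum using (_⊎_; inj₁; inj₂)
open import Function using (_∘_)
open import Function.Bundles using (_⇔_; mk⇔)
open import Relation.Binary.PropositionalEquality
open import Relation.Nullary using (¬_; contradiction)
open _∣_ using (equality)

-- ΘOdd a b unfolds to OddInverse (red₁ a b) (red₂ a b).
OddInverse : ℕ → ℕ → Set
OddInverse m n = ∃ λ t → (0 < t × t < n × ∃ λ k → m * t ≡ 1 + k * n) × Odd t

odd-1+2* : ∀ n → Odd (1 + 2 * n)
odd-1+2* n (divides q 1+2n≡q*2) = even≢odd q n (trans (*-comm 2 q) (sym 1+2n≡q*2))

odd⇒≡1+2* : ∀ {n} → Odd n → ∃ λ h → n ≡ 1 + 2 * h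
odd⇒≡1+2* {n} odd-n with n % 2 in n%2≡r | m%n<n n 2
... | 0           | _               = contradiction (m%n≡0⇒n∣m n 2 n%2≡r) odd-n
... | 1           | _               = n / 2 , trans (m≡m%n+[m/n]*n n 2) (cong₂ _+_ n%2≡r (*-comm (n / 2) 2))
... | suc (suc _) | s≤s (s≤s ())

inverse-of-even⇒odd-modulus : ∀ {m n t k} → 2 ∣ m → m * t ≡ 1 + k * n → Odd n
inverse-of-even⇒odd-modulus {n = n} {t} {k} 2∣m mt≡1+kn 2∣n =
  contradiction (∣1⇒≡1 2∣1) λ ()
  where
  2∣1 : 2 ∣ 1
  2∣1 = ∣m+n∣m⇒∣n (subst (2 ∣_) (trans mt≡1+kn (+-comm 1 (k * n))) (∣m⇒∣m*n t 2∣m))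
                  (subst (2 ∣_) (*-comm n k) (∣m⇒∣m*n k 2∣n))

cofactor< : ∀ {m n t k} → m * t ≡ 1 + k * n → t < n → k < m
cofactor< {zero}      ()
cofactor< {m@(suc _)} {n} {t} {k} mt≡1+kn t<n = *-cancelʳ-< n k m (begin-strict
  k * n      <⟨ n<1+n (k * n) ⟩
  1 + k * n  ≡⟨ mt≡1+kn ⟨
  m * t      <⟨ *-monoʳ-< m t<n ⟩
  m * n      ∎)
  where open ≤-Reasoning

usesE1⇒oddInverse : ∀ {A B} → 1 < A → 0 < B → UsesE1 A B → OddInverse B A
usesE1⇒oddInverse {A@(suc A')} {B@(suc B')} (s≤s A'>0) _ (x , y , solution) =
  let k , 2x+k≡B' = m≤n⇒∃[o]m+o≡n 2x≤B'
  in 1 + 2 * y , (z<s , s≤s 2y<A' , k , inverse 2x+k≡B') , odd-1+2* y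
  where
  instance
    _ : NonZero A'
    _ = >-nonZero A'>0
  2y<A' : 2 * y < A'
  2y<A' = *-cancelˡ-< B (2 * y) A' (begin-strict
    B * (2 * y)            ≡⟨ solve (B' ∷ y ∷ []) ⟩
    2 * (B * y)            ≤⟨ *-monoʳ-≤ 2 (m≤n+m (B * y) (A * x)) ⟩
    2 * (A * x + B * y)    ≡⟨ solution ⟩
    A' * B'                <⟨ *-monoʳ-< A' (n<1+n B') ⟩
    A' * B                 ≡⟨ *-comm A' B ⟩
    B * A'                 ∎)
    where open ≤-Reasoning
  2x≤B' : 2 * x ≤ B'
  2x≤B' = *-cancelˡ-≤ A (begin
    A * (2 * x)            ≡⟨ solve (A' ∷ x ∷ []) ⟩
    2 * (A * x)            ≤⟨ *-monoʳ-≤ 2 (m≤m+n (A * x) (B * y)) ⟩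
    2 * (A * x + B * y)    ≡⟨ solution ⟩
    A' * B'                ≤⟨ m≤n+m (A' * B') B' ⟩
    A * B'                 ∎)
    where open ≤-Reasoning
  inverse : ∀ {k} → 2 * x + k ≡ B' → B * (1 + 2 * y) ≡ 1 + k * A
  inverse {k} 2x+k≡B' = +-cancelˡ-≡ (A * (2 * x)) _ _ (begin
    A * (2 * x) + B * (1 + 2 * y)     ≡⟨ solve (A' ∷ B' ∷ x ∷ y ∷ []) ⟩
    1 + (B' + 2 * (A * x + B * y))    ≡⟨ cong (λ e → 1 + (B' + e)) solution ⟩
    1 + A * B'                        ≡⟨ cong (λ e → 1 + A * e) 2x+k≡B' ⟨
    1 + A * (2 * x + k)               ≡⟨ solve (A' ∷ x ∷ k ∷ []) ⟩
    A * (2 * x) + (1 + k * A)         ∎)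
    where open ≡-Reasoning

oddInverse⇒usesE1 : ∀ {A B} → Odd A → OddInverse B A → UsesE1 A B
oddInverse⇒usesE1 {B = B} odd-A (t , (_ , t<A , k , inverse) , odd-t)
  with odd⇒≡1+2* odd-A | odd⇒≡1+2* odd-t | m≤n⇒∃[o]m+o≡n {suc k} {B} (cofactor< inverse t<A)
... | p , refl | m , refl | r , refl = solution balance
  where
  balance : 2 * m * B + r ≡ 2 * (k * p)
  balance = +-cancelˡ-≡ (1 + k) _ _ (begin
    1 + k + (2 * m * B + r)  ≡⟨ solve (m ∷ k ∷ r ∷ []) ⟩
    B * (1 + 2 * m)          ≡⟨ inverse ⟩
    1 + k * (1 + 2 * p)      ≡⟨ solve (p ∷ k ∷ []) ⟩
    1 + k + 2 * (k * p)      ∎)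
    where open ≡-Reasoning
  solution : 2 * m * B + r ≡ 2 * (k * p) → UsesE1 (1 + 2 * p) B
  solution balanced with ∣m+n∣m⇒∣n (subst (2 ∣_) (sym balanced) (m∣m*n (k * p))) (∣m⇒∣m*n B (m∣m*n m))
  ... | divides s refl = s , m , (begin
    2 * ((1 + 2 * p) * s + B * m)          ≡⟨ solve (p ∷ m ∷ k ∷ s ∷ []) ⟩
    (2 * m * B + s * 2) + 2 * p * (s * 2)  ≡⟨ cong (_+ 2 * p * (s * 2)) balanced ⟩
    2 * (k * p) + 2 * p * (s * 2)          ≡⟨ solve (p ∷ k ∷ s ∷ []) ⟩
    2 * p * (k + s * 2)                    ∎)
    where open ≡-Reasoning

usesE1-sym : ∀ A B → UsesE1 A B → UsesE1 B A
usesE1-sym A B (x , y , solution) =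
  y , x , trans (cong (2 *_) (+-comm (B * y) (A * x))) (trans solution (*-comm (A ∸ 1) (B ∸ 1)))

usesE1-1ˡ : ∀ B → UsesE1 1 B
usesE1-1ˡ B = 0 , 0 , cong (2 *_) (*-zeroʳ B)

odd⇒usesE1⇔oddInverse : ∀ {A B} → Odd A → 1 < A → 0 < B → UsesE1 A B ⇔ OddInverse B A
odd⇒usesE1⇔oddInverse {B = B} odd-A A>1 B>0 =
  mk⇔ (usesE1⇒oddInverse A>1 B>0) (oddInverse⇒usesE1 {B = B} odd-A)

even⇒usesE1⇔oddInverse : ∀ {A B} → 2 ∣ A → 0 < A → 1 < B → UsesE1 A B ⇔ OddInverse A B
even⇒usesE1⇔oddInverse {A} {B} 2∣A A>0 B>1 = mk⇔
  (usesE1⇒oddInverse B>1 A>0 ∘ usesE1-sym A B)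
  (λ { inv@(_ , (_ , _ , k , inverse) , _) →
         usesE1-sym B A (oddInverse⇒usesE1 {B} {A} (inverse-of-even⇒odd-modulus {k = k} 2∣A inverse) inv) })

red₁-comm : ∀ {a} b → 0 < a → red₁ b a ≡ red₂ a b
red₁-comm {a} b a>0 = *-cancelʳ-≡ (red₁ b a) (red₂ a b) (gcd a b) (begin
  red₁ b a * gcd a b  ≡⟨ cong (red₁ b a *_) (gcd-comm a b) ⟩
  red₁ b a * gcd b a  ≡⟨ equality (gcd[m,n]∣m b a) ⟨
  b                   ≡⟨ equality (gcd[m,n]∣n a b) ⟩
  red₂ a b * gcd a b  ∎)
  where
  open ≡-Reasoning
  instance
    _ : NonZero (gcd a b)
    _ = ≢-nonZero (gcd[m,n]≢0 a b (inj₁ (>⇒≢ a>0)))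

red₁≡1 : ∀ {a b} → 0 < a → a ∣ b → red₁ a b ≡ 1
red₁≡1 {a} {b} a>0 a∣b = *-cancelʳ-≡ (red₁ a b) 1 a (begin
  red₁ a b * a        ≡⟨ cong (red₁ a b *_) gcd≡a ⟨
  red₁ a b * gcd a b  ≡⟨ equality (gcd[m,n]∣m a b) ⟨
  a                   ≡⟨ *-identityˡ a ⟨
  1 * a               ∎)
  where
  open ≡-Reasoning
  instance
    _ : NonZero a
    _ = >-nonZero a>0
  gcd≡a : gcd a b ≡ a
  gcd≡a = ∣-antisym (gcd[m,n]∣m a b) (gcd-greatest ∣-refl a∣b)

1<red₁ : ∀ {a b} → 0 < a → ¬ a ∣ b → 1 < red₁ a b
1<red₁ {a} {b} a>0 a∤b with red₁ a b | equality (gcd[m,n]∣m a b)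
... | 0           | a≡0   = contradiction a≡0 (>⇒≢ a>0)
... | 1           | a≡1*g =
  contradiction (subst (_∣ b) (sym (trans a≡1*g (*-identityˡ (gcd a b)))) (gcd[m,n]∣n a b)) a∤b
... | suc (suc _) | _     = s≤s (s≤s z≤n)

theorem1p1 : (a b : ℕ) → 1 ≤ a → 1 ≤ b →
    ((a ∣ b ⊎ b ∣ a) → Γ≡1 a b) ×
    (¬ (a ∣ b) → ¬ (b ∣ a) →
      ((Odd (red₁ a b) → (Γ≡1 a b ⇔ ΘOdd b a)) ×
       (2 ∣ red₁ a b → (Γ≡1 a b ⇔ ΘOdd a b))))
theorem1p1 a b a>0 b>0 = divisible , λ a∤b b∤a → oddCase a∤b b∤a , evenCase a∤b b∤a
  where
  red₂≡red₁ : red₂ a b ≡ red₁ b a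
  red₂≡red₁ = sym (red₁-comm b a>0)
  divisible : a ∣ b ⊎ b ∣ a → Γ≡1 a b
  divisible (inj₁ a∣b) =
    subst (λ A → UsesE1 A (red₂ a b)) (sym (red₁≡1 a>0 a∣b)) (usesE1-1ˡ (red₂ a b))
  divisible (inj₂ b∣a) =
    subst (UsesE1 (red₁ a b)) (sym (trans red₂≡red₁ (red₁≡1 b>0 b∣a)))
      (usesE1-sym 1 (red₁ a b) (usesE1-1ˡ (red₁ a b)))
  1<red₂ : ¬ b ∣ a → 1 < red₂ a b
  1<red₂ b∤a = subst (1 <_) (sym red₂≡red₁) (1<red₁ b>0 b∤a)
  oddCase : ¬ a ∣ b → ¬ b ∣ a → Odd (red₁ a b) → Γ≡1 a b ⇔ ΘOdd b a
  oddCase a∤b b∤a odd-A = subst₂ (λ m n → Γ≡1 a b ⇔ OddInverse m n) red₂≡red₁ (red₁-comm a b>0)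
    (odd⇒usesE1⇔oddInverse odd-A (1<red₁ a>0 a∤b) (<-trans z<s (1<red₂ b∤a)))
  evenCase : ¬ a ∣ b → ¬ b ∣ a → 2 ∣ red₁ a b → Γ≡1 a b ⇔ ΘOdd a b
  evenCase a∤b b∤a 2∣A = even⇒usesE1⇔oddInverse 2∣A (<-trans z<s (1<red₁ a>0 a∤b)) (1<red₂ b∤a)
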